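{- Let $A$ be a pseudo BCK-algebra whose order $(A,\le)$ is a meet-semilattice, and let $\mu$ be a type I or type II state operator on $A$ satisfying $\mu(x\rightarrow y)=\mu(x)\rightarrow\mu(x\wedge y)$ and $\mu(x\rightsquigarrow y)=\mu(x)\rightsquigarrow\mu(x\wedge y)$ for all $x,y\in A$. Then $\mu$ is a normal state operator on $A$, i.e. ${\rm Ker}(\mu)$ is a normal deductive system of $A$.
   Context: A pseudo BCK-algebra is an algebra $(A,\rightarrow,\rightsquigarrow,1)$ of type $(2,2,0)$ such that for all $x,y,z\in A$: $(x\rightarrow y)\rightsquigarrow[(y\rightarrow z)\rightsquigarrow(x\rightarrow z)]=1$; $(x\rightsquigarrow y)\rightarrow[(y\rightsquigarrow z)\rightarrow(x\rightsquigarrow z)]=1$; $1\rightarrow x=x$; $1\rightsquigarrow x=x$; $x\rightarrow 1=1$; and if $x\rightarrow y=1$ and $y\rightarrow x=1$ then $x=y$. The order is $x\le y$ iff $x\rightarrow y=1$ (iff $x\rightsquigarrow y=1$). A deductive system is a subset $D$ with $1\in D$ such that $x, x\rightarrow y\in D$ imply $y\in D$; it is normal if $x\rightarrow y\in D$ iff $x\rightsquigarrow y\in D$. For $\mu:A\to A$ consider, for all $x,y\in A$: $(IS_1)$ $x\le y$ implies $\mu(x)\le\mu(y)$; $(IS_2)$ $\mu(x\rightarrow y)=\mu((x\rightarrow y)\rightsquigarrow y)\rightarrow\mu(y)$ and $\mu(x\rightsquigarrow y)=\mu((x\rightsquigarrow y)\rightarrow y)\rightsquigarrow\mu(y)$;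 $(IS_2')$ $\mu(x\rightarrow y)=\mu((y\rightarrow x)\rightsquigarrow x)\rightarrow\mu(y)$ and $\mu(x\rightsquigarrow y)=\mu((y\rightsquigarrow x)\rightarrow x)\rightsquigarrow\mu(y)$; $(IS_3)$ $\mu(\mu(x)\rightarrow\mu(y))=\mu(x)\rightarrow\mu(y)$ and $\mu(\mu(x)\rightsquigarrow\mu(y))=\mu(x)\rightsquigarrow\mu(y)$. A type I state operator satisfies $(IS_1),(IS_2),(IS_3)$; a type II one satisfies $(IS_1),(IS_2'),(IS_3)$. ${\rm Ker}(\mu)=\{x\in A\mid\mu(x)=1\}$; $\mu$ is normal if ${\rm Ker}(\mu)$ is a normal deductive system. -}

module Defs where

open import Level using (Level; suc; _⊔_)
open import Relation.Binary.PropositionalEquality using (_≡_)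
open import Data.Product using (_×_)
open import Data.Sum using (_⊎_)

record PseudoBCK (a : Level) : Set (suc a) where
  infixr 5 _⇒_ _⇝_
  field
    Carrier : Set a
    _⇒_     : Carrier → Carrier → Carrier
    _⇝_     : Carrier → Carrier → Carrier
    𝟙       : Carrier
    ax1 : ∀ x y z → (x ⇒ y) ⇝ ((y ⇒ z) ⇝ (x ⇒ z)) ≡ 𝟙
    ax2 : ∀ x y z → (x ⇝ y) ⇒ ((y ⇝ z) ⇒ (x ⇝ z)) ≡ 𝟙
    ax3 : ∀ x → 𝟙 ⇒ x ≡ x
    ax4 : ∀ x → 𝟙 ⇝ x ≡ x
    ax5 : ∀ x → x ⇒ 𝟙 ≡ 𝟙
    ax6 : ∀ x y → x ⇒ y ≡ 𝟙 → y ⇒ x ≡ 𝟙 → x ≡ y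

  _≤_ : Carrier → Carrier → Set a
  x ≤ y = x ⇒ y ≡ 𝟙

module _ {a : Level} (A : PseudoBCK a) where
  open PseudoBCK A

  IsMeet : (Carrier → Carrier → Carrier) → Set a
  IsMeet _∧_ = (∀ x y → (x ∧ y) ≤ x) × (∀ x y → (x ∧ y) ≤ y)
             × (∀ x y z → z ≤ x → z ≤ y → z ≤ (x ∧ y))

  IS₁ : (Carrier → Carrier) → Set a
  IS₁ μ = ∀ x y → x ≤ y → μ x ≤ μ y

  IS₂ : (Carrier → Carrier) → Set a
  IS₂ μ = ∀ x y → (μ (x ⇒ y) ≡ μ ((x ⇒ y) ⇝ y) ⇒ μ y)
                × (μ (x ⇝ y) ≡ μ ((x ⇝ y) ⇒ y) ⇝ μ y)

  IS₂' : (Carrier → Carrier) → Set a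
  IS₂' μ = ∀ x y → (μ (x ⇒ y) ≡ μ ((y ⇒ x) ⇝ x) ⇒ μ y)
                 × (μ (x ⇝ y) ≡ μ ((y ⇝ x) ⇒ x) ⇝ μ y)

  IS₃ : (Carrier → Carrier) → Set a
  IS₃ μ = ∀ x y → (μ (μ x ⇒ μ y) ≡ μ x ⇒ μ y)
                × (μ (μ x ⇝ μ y) ≡ μ x ⇝ μ y)

  TypeIStateOperator : (Carrier → Carrier) → Set a
  TypeIStateOperator μ = IS₁ μ × IS₂ μ × IS₃ μ

  TypeIIStateOperator : (Carrier → Carrier) → Set a
  TypeIIStateOperator μ = IS₁ μ × IS₂' μ × IS₃ μ

  IsDeductiveSystem : (Carrier → Set a) → Set a
  IsDeductiveSystem D = D 𝟙 × (∀ x y → D x → D (x ⇒ y) → D y)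

  IsNormalDeductiveSystem : (Carrier → Set a) → Set a
  IsNormalDeductiveSystem D =
    IsDeductiveSystem D × (∀ x y → (D (x ⇒ y) → D (x ⇝ y)) × (D (x ⇝ y) → D (x ⇒ y)))

  Ker : (Carrier → Carrier) → Carrier → Set a
  Ker μ x = μ x ≡ 𝟙

  IsNormalStateOperator : (Carrier → Carrier) → Set a
  IsNormalStateOperator μ = IsNormalDeductiveSystem (Ker μ)

-- Only monotonicity (IS₁) and idempotence on arrows (IS₃) are needed, so the
-- type of the state operator is irrelevant. IS₃ at x = y = 1 gives μ 1 = 1.
-- If μ x = 1 and μ (x → y) = 1, the hypothesis turns the latter into
-- 1 → μ (x ∧ y) = 1, i.e. μ (x ∧ y) = 1, and monotonicity along x ∧ y ≤ y
-- yields μ y = 1. Normality holds because μ (x → y) = 1 and μ (x ⇝ y) = 1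
-- both say μ x ≤ μ (x ∧ y), and → and ⇝ define the same order.
module Submission where

open import Defs
open import Level using (Level)
open import Relation.Binary.PropositionalEquality using (_≡_; refl; sym; trans; cong; cong₂; subst; module ≡-Reasoning)
open import Data.Product using (_×_; _,_; proj₁; proj₂)
open import Data.Sum using (_⊎_; [_,_])
open import Function using (_∘_)

module PseudoBCKProperties {a : Level} (A : PseudoBCK a) where
  open PseudoBCK A
  open ≡-Reasoning

  ⇝-refl : ∀ x → x ⇝ x ≡ 𝟙
  ⇝-refl x = begin
    x ⇝ x                           ≡⟨ sym (ax4 _) ⟩
    𝟙 ⇝ (x ⇝ x)                     ≡⟨ cong₂ (λ u v → u ⇝ (v ⇝ v)) (sym (ax3 𝟙)) (sym (ax3 x)) ⟩
    (𝟙 ⇒ 𝟙) ⇝ ((𝟙 ⇒ x) ⇝ (𝟙 ⇒ x))   ≡⟨ ax1 𝟙 𝟙 x ⟩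
    𝟙                               ∎

  ⇒-refl : ∀ x → x ⇒ x ≡ 𝟙
  ⇒-refl x = begin
    x ⇒ x                           ≡⟨ sym (ax3 _) ⟩
    𝟙 ⇒ (x ⇒ x)                     ≡⟨ cong₂ (λ u v → u ⇒ (v ⇒ v)) (sym (ax4 𝟙)) (sym (ax4 x)) ⟩
    (𝟙 ⇝ 𝟙) ⇒ ((𝟙 ⇝ x) ⇒ (𝟙 ⇝ x))   ≡⟨ ax2 𝟙 𝟙 x ⟩
    𝟙                               ∎

  ⇒≡𝟙⇒⇝≡𝟙 : ∀ x y → x ⇒ y ≡ 𝟙 → x ⇝ y ≡ 𝟙
  ⇒≡𝟙⇒⇝≡𝟙 x y x⇒y≡𝟙 = begin
    x ⇝ y                           ≡⟨ cong (x ⇝_) (sym (ax4 y)) ⟩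
    x ⇝ (𝟙 ⇝ y)                     ≡⟨ cong₂ (λ u v → u ⇝ (v ⇝ y)) (sym (ax3 x)) (sym x⇒y≡𝟙) ⟩
    (𝟙 ⇒ x) ⇝ ((x ⇒ y) ⇝ y)         ≡⟨ cong (λ v → (𝟙 ⇒ x) ⇝ ((x ⇒ y) ⇝ v)) (sym (ax3 y)) ⟩
    (𝟙 ⇒ x) ⇝ ((x ⇒ y) ⇝ (𝟙 ⇒ y))   ≡⟨ ax1 𝟙 x y ⟩
    𝟙                               ∎

  ⇝≡𝟙⇒⇒≡𝟙 : ∀ x y → x ⇝ y ≡ 𝟙 → x ⇒ y ≡ 𝟙
  ⇝≡𝟙⇒⇒≡𝟙 x y x⇝y≡𝟙 = begin
    x ⇒ y                           ≡⟨ cong (x ⇒_) (sym (ax3 y)) ⟩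
    x ⇒ (𝟙 ⇒ y)                     ≡⟨ cong₂ (λ u v → u ⇒ (v ⇒ y)) (sym (ax4 x)) (sym x⇝y≡𝟙) ⟩
    (𝟙 ⇝ x) ⇒ ((x ⇝ y) ⇒ y)         ≡⟨ cong (λ v → (𝟙 ⇝ x) ⇒ ((x ⇝ y) ⇒ v)) (sym (ax4 y)) ⟩
    (𝟙 ⇝ x) ⇒ ((x ⇝ y) ⇒ (𝟙 ⇝ y))   ≡⟨ ax2 𝟙 x y ⟩
    𝟙                               ∎

  𝟙≤⇒≡𝟙 : ∀ x → 𝟙 ≤ x → x ≡ 𝟙
  𝟙≤⇒≡𝟙 x 𝟙≤x = trans (sym (ax3 x)) 𝟙≤x

  ≤-closed-𝟙 : ∀ x y → x ≤ y → x ≡ 𝟙 → y ≡ 𝟙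
  ≤-closed-𝟙 x y x≤y refl = 𝟙≤⇒≡𝟙 y x≤y

module StateOperatorProperties {a : Level} (A : PseudoBCK a) (μ : PseudoBCK.Carrier A → PseudoBCK.Carrier A) where
  open PseudoBCK A
  open PseudoBCKProperties A

  IS₃⇒μ𝟙≡𝟙 : IS₃ A μ → μ 𝟙 ≡ 𝟙
  IS₃⇒μ𝟙≡𝟙 is₃ = begin
    μ 𝟙                ≡⟨ cong μ (sym (⇒-refl (μ 𝟙))) ⟩
    μ (μ 𝟙 ⇒ μ 𝟙)      ≡⟨ proj₁ (is₃ 𝟙 𝟙) ⟩
    μ 𝟙 ⇒ μ 𝟙          ≡⟨ ⇒-refl (μ 𝟙) ⟩
    𝟙                  ∎
    where open ≡-Reasoning

  module _ (_∧_ : Carrier → Carrier → Carrier) where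

    Ker-closed-⇒ : IS₁ A μ → (∀ x y → (x ∧ y) ≤ y)
                 → (∀ x y → μ (x ⇒ y) ≡ μ x ⇒ μ (x ∧ y))
                 → ∀ x y → Ker A μ x → Ker A μ (x ⇒ y) → Ker A μ y
    Ker-closed-⇒ is₁ ∧≤ʳ μ⇒ x y μx≡𝟙 μx⇒y≡𝟙 =
      ≤-closed-𝟙 (μ (x ∧ y)) (μ y) (is₁ _ _ (∧≤ʳ x y)) μx∧y≡𝟙
      where
      μx∧y≡𝟙 : μ (x ∧ y) ≡ 𝟙
      μx∧y≡𝟙 = 𝟙≤⇒≡𝟙 _ (subst (λ u → u ⇒ μ (x ∧ y) ≡ 𝟙) μx≡𝟙 (trans (sym (μ⇒ x y)) μx⇒y≡𝟙))

    Ker-⇒→⇝ : (∀ x y → μ (x ⇒ y) ≡ μ x ⇒ μ (x ∧ y))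
            → (∀ x y → μ (x ⇝ y) ≡ μ x ⇝ μ (x ∧ y))
            → ∀ x y → Ker A μ (x ⇒ y) → Ker A μ (x ⇝ y)
    Ker-⇒→⇝ μ⇒ μ⇝ x y μx⇒y≡𝟙 =
      trans (μ⇝ x y) (⇒≡𝟙⇒⇝≡𝟙 _ _ (trans (sym (μ⇒ x y)) μx⇒y≡𝟙))

    Ker-⇝→⇒ : (∀ x y → μ (x ⇒ y) ≡ μ x ⇒ μ (x ∧ y))
            → (∀ x y → μ (x ⇝ y) ≡ μ x ⇝ μ (x ∧ y))
            → ∀ x y → Ker A μ (x ⇝ y) → Ker A μ (x ⇒ y)
    Ker-⇝→⇒ μ⇒ μ⇝ x y μx⇝y≡𝟙 =
      trans (μ⇒ x y) (⇝≡𝟙⇒⇒≡𝟙 _ _ (trans (sym (μ⇝ x y)) μx⇝y≡𝟙))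

proposition5p10 : {a : Level} (A : PseudoBCK a) (_∧_ : PseudoBCK.Carrier A → PseudoBCK.Carrier A → PseudoBCK.Carrier A)
    → IsMeet A _∧_
    → (μ : PseudoBCK.Carrier A → PseudoBCK.Carrier A)
    → TypeIStateOperator A μ ⊎ TypeIIStateOperator A μ
    → (∀ x y → (μ (PseudoBCK._⇒_ A x y) ≡ PseudoBCK._⇒_ A (μ x) (μ (x ∧ y)))
             × (μ (PseudoBCK._⇝_ A x y) ≡ PseudoBCK._⇝_ A (μ x) (μ (x ∧ y))))
    → IsNormalStateOperator A μ
proposition5p10 A _∧_ (_ , ∧≤ʳ , _) μ stateOperator μ-arrows =
  ( IS₃⇒μ𝟙≡𝟙 is₃
  , Ker-closed-⇒ _∧_ is₁ ∧≤ʳ μ⇒)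
  , λ x y → Ker-⇒→⇝ _∧_ μ⇒ μ⇝ x y , Ker-⇝→⇒ _∧_ μ⇒ μ⇝ x y
  where
  open PseudoBCK A
  open StateOperatorProperties A μ
  is₁ : IS₁ A μ
  is₁ = [ proj₁ , proj₁ ] stateOperator
  is₃ : IS₃ A μ
  is₃ = [ proj₂ ∘ proj₂ , proj₂ ∘ proj₂ ] stateOperator
  μ⇒ : ∀ x y → μ (x ⇒ y) ≡ μ x ⇒ μ (x ∧ y)
  μ⇒ x y = proj₁ (μ-arrows x y)
  μ⇝ : ∀ x y → μ (x ⇝ y) ≡ μ x ⇝ μ (x ∧ y)
  μ⇝ x y = proj₂ (μ-arrows x y)
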